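{- There do not exist four sets $T_1, T_2, T_3, T_4$, each of size $16$ and each contained in some $2\times3\times3$ prism, that partition $[4]^3$.
   Context: $[4] = \{0,1,2,3\}$. A $2\times3\times3$ prism in $[4]^3$ is a Cartesian product $A\times B\times C$ of subsets of $[4]$ in which one of the three factors has size $2$ and the other two have size $3$ (in any order/orientation). -}

module Defs where

open import Data.Nat using (ℕ; _+_)
open import Data.Bool using (Bool; true; false; T)
open import Data.Fin using (Fin)
open import Data.Fin.Subset using (Subset; _∈_; ∣_∣)
open import Data.Product using (_×_; Σ; ∃)
open import Data.Sum using (_⊎_)
open import Data.List using (List; allFin; map)
open import Data.Nat.ListAction using (sum)
open import Relation.Binary.PropositionalEquality using (_≡_)

-- [4] = {0,1,2,3} is Fin 4.  A subset of [4]^3 is a Boolean-valued predicate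
-- on triples (decidable, as every subset of a finite set).
Set³ : Set
Set³ = Fin 4 → Fin 4 → Fin 4 → Bool

_∈³_ : Fin 4 × Fin 4 × Fin 4 → Set³ → Set
(x Data.Product., y Data.Product., z) ∈³ S = T (S x y z)

count : Bool → ℕ
count true = 1
count false = 0

size³ : Set³ → ℕ
size³ S = sum (map (λ x → sum (map (λ y → sum (map (λ z → count (S x y z)) (allFin 4))) (allFin 4))) (allFin 4))

_⊆Prod_ : Set³ → Subset 4 × Subset 4 × Subset 4 → Set
S ⊆Prod (A Data.Product., B Data.Product., C) =
  ∀ x y z → T (S x y z) → (x ∈ A) × (y ∈ B) × (z ∈ C)

Is233Prism : Subset 4 × Subset 4 × Subset 4 → Set
Is233Prism (A Data.Product., B Data.Product., C) =
    (∣ A ∣ ≡ 2 × ∣ B ∣ ≡ 3 × ∣ C ∣ ≡ 3)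
  ⊎ (∣ A ∣ ≡ 3 × ∣ B ∣ ≡ 2 × ∣ C ∣ ≡ 3)
  ⊎ (∣ A ∣ ≡ 3 × ∣ B ∣ ≡ 3 × ∣ C ∣ ≡ 2)

InSomePrism : Set³ → Set
InSomePrism S = Σ (Subset 4 × Subset 4 × Subset 4) λ P → Is233Prism P × S ⊆Prod P

Partitions : (Fin 4 → Set³) → Set
Partitions Ts = ∀ x y z →
  Σ (Fin 4) λ i → T (Ts i x y z) × (∀ j → T (Ts j x y z) → j ≡ i)

-- Fix a value x of the first coordinate.
-- Two boxes j, l never cover the slice {x} × [4] × [4]: a y missed by the second factor of j and
-- a z missed by the third factor of l give a point (x, y, z) outside both. So x lies in the first
-- factor of at least three of the four prisms, and double counting makes these factors have total
-- size at least 3 · 4 = 12. The same holds in the other two coordinates, so the side lengths of the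
-- four prisms sum to at least 36; but every 2×3×3 prism contributes 2 + 3 + 3 = 8, i.e. 32 in all.

module Submission where

open import Defs
open import Data.Fin using (Fin; zero; suc)
open import Data.Fin.Subset using (Subset; _∈_; _∉_; _-_; ∣_∣; ⊤)
open import Data.Fin.Subset.Properties
  using (_∈?_; ∣⊤∣≡n; p⊆q⇒∣p∣≤∣q∣; x∈p⇒∣p-x∣<∣p∣; x∈p∧x≢y⇒x∈p-y)
open import Data.Fin.Properties using (¬∀⟶∃¬)
open import Data.Nat using (ℕ; zero; suc; _+_; _*_; _≤_; _<_; z≤n; s≤s)
open import Data.Nat.Properties
  using ( +-0-commutativeMonoid; +-mono-≤; ≤-trans; <⇒≱; m≤m+n; n<1+n; m<n⇒m<1+n; *-distribˡ-+
        ; module ≤-Reasoning)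
open import Algebra.Properties.CommutativeMonoid.Sum +-0-commutativeMonoid
  using (sum-cong-≗; ∑-comm; ∑-distrib-+; sum; sum-syntax)
open import Data.Bool using (true; false)
open import Data.Vec using (_∷_; []; lookup; tabulate)
open import Data.Vec.Properties using (lookup∘tabulate; lookup⇒[]=; []=⇒lookup)
open import Data.Product using (Σ; ∃; _×_; _,_; proj₁; proj₂)
open import Data.Sum using (inj₁; inj₂)
open import Function using (_∘_)
open import Relation.Nullary using (¬_)
open import Relation.Binary.PropositionalEquality
  using (_≡_; _≢_; refl; sym; trans; cong; cong₂; subst; module ≡-Reasoning)

private
  variable
    k n : ℕ

Box : ℕ → Set
Box n = Subset n × Subset n × Subset n

_∈ᵇ_ : Fin n × Fin n × Fin n → Box n → Set
(x , y , z) ∈ᵇ (A , B , C) = x ∈ A × y ∈ B × z ∈ C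

Covers : (Fin k → Box n) → Set
Covers boxes = ∀ p → ∃ λ m → p ∈ᵇ boxes m

Proper : Box n → Set
Proper (A , B , C) = (∃ λ x → x ∉ A) × (∃ λ y → y ∉ B) × (∃ λ z → z ∉ C)

first second third : Box n → Subset n
first  = proj₁
second = proj₁ ∘ proj₂
third  = proj₂ ∘ proj₂

sideSum : Box n → ℕ
sideSum (A , B , C) = ∣ A ∣ + ∣ B ∣ + ∣ C ∣

rotate : Box n → Box n
rotate (A , B , C) = B , C , A

rotate-covers : {boxes : Fin k → Box n} → Covers boxes → Covers (rotate ∘ boxes)
rotate-covers covers (x , y , z) =
  let m , z∈A , x∈B , y∈C = covers (z , x , y) in m , x∈B , y∈C , z∈A

rotate-proper : {b : Box n} → Proper b → Proper (rotate b)
rotate-proper (∉A , ∉B , ∉C) = ∉B , ∉C , ∉A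

∣p∣<n⇒∃∉ : (p : Subset n) → ∣ p ∣ < n → ∃ λ x → x ∉ p
∣p∣<n⇒∃∉ {n} p ∣p∣<n = ¬∀⟶∃¬ n (_∈ p) (_∈? p) ⊤⊈p
  where
  ⊤⊈p : ¬ (∀ x → x ∈ p)
  ⊤⊈p all∈p = <⇒≱ ∣p∣<n (subst (_≤ ∣ p ∣) (∣⊤∣≡n n) (p⊆q⇒∣p∣≤∣q∣ {p = ⊤} λ {x} _ → all∈p x))

fibre-escapes-two-boxes : {boxes : Fin k → Box n} → Covers boxes → (∀ i → Proper (boxes i)) →
                          ∀ x j l → ∃ λ m → m ≢ j × m ≢ l × x ∈ first (boxes m)
fibre-escapes-two-boxes {boxes = boxes} covers proper x j l =
  let _ , (y , y∉Bj) , _ = proper j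
      _ , _ , (z , z∉Cl) = proper l
  in escape y∉Bj z∉Cl (covers (x , y , z))
  where
  escape : ∀ {y z} → y ∉ second (boxes j) → z ∉ third (boxes l) →
           (∃ λ m → (x , y , z) ∈ᵇ boxes m) → ∃ λ m → m ≢ j × m ≢ l × x ∈ first (boxes m)
  escape y∉Bj z∉Cl (m , x∈Am , y∈Bm , z∈Cm) =
    m , (λ { refl → y∉Bj y∈Bm }) , (λ { refl → z∉Cl z∈Cm }) , x∈Am

avoids-pairs⇒3≤∣p∣ : {p : Subset k} → Fin k → (∀ j l → ∃ λ m → m ≢ j × m ≢ l × m ∈ p) → 3 ≤ ∣ p ∣
avoids-pairs⇒3≤∣p∣ i avoids =
  let m₁ , _ , _ , m₁∈p = avoids i i
      m₂ , m₂≢m₁ , _ , m₂∈p = avoids m₁ m₁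
      _ , m₃≢m₁ , m₃≢m₂ , m₃∈p = avoids m₁ m₂
  in peel m₁∈p (peel (x∈p∧x≢y⇒x∈p-y m₂∈p m₂≢m₁)
                     (peel (x∈p∧x≢y⇒x∈p-y (x∈p∧x≢y⇒x∈p-y m₃∈p m₃≢m₁) m₃≢m₂) z≤n))
  where
  peel : ∀ {r m} {q : Subset k} → m ∈ q → r ≤ ∣ q - m ∣ → suc r ≤ ∣ q ∣
  peel m∈q r≤∣q-m∣ = ≤-trans (s≤s r≤∣q-m∣) (x∈p⇒∣p-x∣<∣p∣ m∈q)

containing : (Fin k → Subset n) → Fin n → Subset k
containing A x = tabulate λ i → lookup (A i) x

∈-containing : (A : Fin k → Subset n) {x : Fin n} {i : Fin k} → x ∈ A i → i ∈ containing A x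
∈-containing A {x} {i} x∈Ai =
  lookup⇒[]= i (containing A x) (trans (lookup∘tabulate _ i) ([]=⇒lookup x∈Ai))

∣p∣≡∑count : (p : Subset n) → ∣ p ∣ ≡ ∑[ x < n ] count (lookup p x)
∣p∣≡∑count []          = refl
∣p∣≡∑count (true ∷ p)  = cong suc (∣p∣≡∑count p)
∣p∣≡∑count (false ∷ p) = ∣p∣≡∑count p

∑∣A∣≡∑∣containing∣ : (A : Fin k → Subset n) → ∑[ i < k ] ∣ A i ∣ ≡ ∑[ x < n ] ∣ containing A x ∣
∑∣A∣≡∑∣containing∣ {k} {n} A = begin
  ∑[ i < k ] ∣ A i ∣                           ≡⟨ sum-cong-≗ (∣p∣≡∑count ∘ A) ⟩
  ∑[ i < k ] ∑[ x < n ] count (lookup (A i) x) ≡⟨ ∑-comm (λ i x → count (lookup (A i) x)) ⟩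
  ∑[ x < n ] ∑[ i < k ] count (lookup (A i) x) ≡⟨ sum-cong-≗ (sym ∘ ∣containing∣≡∑count) ⟩
  ∑[ x < n ] ∣ containing A x ∣                ∎
  where
  open ≡-Reasoning
  ∣containing∣≡∑count : ∀ x → ∣ containing A x ∣ ≡ ∑[ i < k ] count (lookup (A i) x)
  ∣containing∣≡∑count x = trans (∣p∣≡∑count (containing A x))
                                (sum-cong-≗ (cong count ∘ lookup∘tabulate (λ i → lookup (A i) x)))

∑-const-≤ : ∀ {c} (f : Fin n → ℕ) → (∀ x → c ≤ f x) → n * c ≤ ∑[ x < n ] f x
∑-const-≤ {zero}  f c≤f = z≤n
∑-const-≤ {suc n} f c≤f = +-mono-≤ (c≤f zero) (∑-const-≤ (f ∘ suc) (c≤f ∘ suc))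

n*3≤∑∣first∣ : {boxes : Fin k → Box n} → Covers boxes → (∀ i → Proper (boxes i)) →
               n * 3 ≤ ∑[ i < k ] ∣ first (boxes i) ∣
n*3≤∑∣first∣ {boxes = boxes} covers proper =
  subst (_ ≤_) (sym (∑∣A∣≡∑∣containing∣ (first ∘ boxes))) (∑-const-≤ _ multiplicity≥3)
  where
  multiplicity≥3 : ∀ x → 3 ≤ ∣ containing (first ∘ boxes) x ∣
  multiplicity≥3 x = avoids-pairs⇒3≤∣p∣ (proj₁ (covers (x , x , x))) λ j l →
    let m , m≢j , m≢l , x∈Am = fibre-escapes-two-boxes covers proper x j l
    in m , m≢j , m≢l , ∈-containing (first ∘ boxes) x∈Am

n*9≤∑sideSum : {boxes : Fin k → Box n} → Covers boxes → (∀ i → Proper (boxes i)) →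
               n * 9 ≤ ∑[ i < k ] sideSum (boxes i)
n*9≤∑sideSum {k} {n} {boxes} covers proper = begin
  n * 9
    ≡⟨ trans (*-distribˡ-+ n 6 3) (cong (_+ n * 3) (*-distribˡ-+ n 3 3)) ⟩
  n * 3 + n * 3 + n * 3
    ≤⟨ +-mono-≤ (+-mono-≤ (n*3≤∑∣first∣ covers proper) (n*3≤∑∣first∣ covers′ proper′))
                (n*3≤∑∣first∣ covers″ proper″) ⟩
  sum ∣first∣ + sum ∣second∣ + sum ∣third∣
    ≡⟨ cong (_+ sum ∣third∣) (∑-distrib-+ ∣first∣ ∣second∣) ⟨
  sum (λ i → ∣first∣ i + ∣second∣ i) + sum ∣third∣
    ≡⟨ ∑-distrib-+ (λ i → ∣first∣ i + ∣second∣ i) ∣third∣ ⟨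
  ∑[ i < k ] sideSum (boxes i)
    ∎
  where
  open ≤-Reasoning
  ∣first∣ ∣second∣ ∣third∣ : Fin k → ℕ
  ∣first∣  i = ∣ first (boxes i) ∣
  ∣second∣ i = ∣ second (boxes i) ∣
  ∣third∣  i = ∣ third (boxes i) ∣
  covers′ = rotate-covers covers
  proper′ = rotate-proper ∘ proper
  covers″ = rotate-covers covers′
  proper″ = rotate-proper ∘ proper′

∣p∣≡2⇒∃∉ : (p : Subset 4) → ∣ p ∣ ≡ 2 → ∃ λ x → x ∉ p
∣p∣≡2⇒∃∉ p ∣p∣≡2 = ∣p∣<n⇒∃∉ p (subst (_< 4) (sym ∣p∣≡2) (m<n⇒m<1+n (n<1+n 2)))

∣p∣≡3⇒∃∉ : (p : Subset 4) → ∣ p ∣ ≡ 3 → ∃ λ x → x ∉ p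
∣p∣≡3⇒∃∉ p ∣p∣≡3 = ∣p∣<n⇒∃∉ p (subst (_< 4) (sym ∣p∣≡3) (n<1+n 3))

prism-proper : (b : Box 4) → Is233Prism b → Proper b
prism-proper (A , B , C) (inj₁ (∣A∣≡2 , ∣B∣≡3 , ∣C∣≡3)) =
  ∣p∣≡2⇒∃∉ A ∣A∣≡2 , ∣p∣≡3⇒∃∉ B ∣B∣≡3 , ∣p∣≡3⇒∃∉ C ∣C∣≡3
prism-proper (A , B , C) (inj₂ (inj₁ (∣A∣≡3 , ∣B∣≡2 , ∣C∣≡3))) =
  ∣p∣≡3⇒∃∉ A ∣A∣≡3 , ∣p∣≡2⇒∃∉ B ∣B∣≡2 , ∣p∣≡3⇒∃∉ C ∣C∣≡3
prism-proper (A , B , C) (inj₂ (inj₂ (∣A∣≡3 , ∣B∣≡3 , ∣C∣≡2))) =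
  ∣p∣≡3⇒∃∉ A ∣A∣≡3 , ∣p∣≡3⇒∃∉ B ∣B∣≡3 , ∣p∣≡2⇒∃∉ C ∣C∣≡2

prism-sideSum : (b : Box 4) → Is233Prism b → sideSum b ≡ 8
prism-sideSum (A , B , C) (inj₁ (∣A∣≡2 , ∣B∣≡3 , ∣C∣≡3))        = cong₂ _+_ (cong₂ _+_ ∣A∣≡2 ∣B∣≡3) ∣C∣≡3
prism-sideSum (A , B , C) (inj₂ (inj₁ (∣A∣≡3 , ∣B∣≡2 , ∣C∣≡3))) = cong₂ _+_ (cong₂ _+_ ∣A∣≡3 ∣B∣≡2) ∣C∣≡3
prism-sideSum (A , B , C) (inj₂ (inj₂ (∣A∣≡3 , ∣B∣≡3 , ∣C∣≡2))) = cong₂ _+_ (cong₂ _+_ ∣A∣≡3 ∣B∣≡3) ∣C∣≡2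

mainTheorem10 : ¬ (Σ (Fin 4 → Set³) λ Ts →
                    ((i : Fin 4) → size³ (Ts i) ≡ 16 × InSomePrism (Ts i))
                    × Partitions Ts)
mainTheorem10 (Ts , sized-in-prism , partition) = <⇒≱ (m≤m+n 33 3) 36≤32
  where
  prism : Fin 4 → Box 4
  prism i = proj₁ (proj₂ (sized-in-prism i))
  is233 : ∀ i → Is233Prism (prism i)
  is233 i = proj₁ (proj₂ (proj₂ (sized-in-prism i)))
  covers : Covers prism
  covers (x , y , z) = let m , xyz∈Tm , _ = partition x y z
                       in m , proj₂ (proj₂ (proj₂ (sized-in-prism m))) x y z xyz∈Tm
  36≤32 : 36 ≤ 32
  36≤32 = subst (36 ≤_) (sum-cong-≗ λ i → prism-sideSum (prism i) (is233 i))
                (n*9≤∑sideSum covers λ i → prism-proper (prism i) (is233 i))
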